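{- Let $\epsilon>0$ and let $D$ be a dendrogram of $G$ obtained by a HAC run in which every merge is $(1+\epsilon)$-good (with respect to the contracted graph at the moment the merge is performed). Then $D$ is $(1+\epsilon)$-approximate.
   Context: $G=(V,E,w)$ is a finite undirected graph with positive edge weights. For disjoint nonempty $X,Y\subseteq V$, $w(X,Y)=\frac{1}{|X||Y|}\sum_{xy\in E,x\in X,y\in Y}w(xy)$. Given a partition of $V$ into clusters, the contracted graph has the clusters as vertices and an edge of weight $w(X,Y)$ between $X,Y$ iff $w(X,Y)>0$. A HAC run starts from all-singleton clusters and repeatedly merges two clusters $X,Y$ with $w(X,Y)>0$ into $X\cup Y$, until no two clusters have positive similarity; its dendrogram is the rooted binary forest with the singletons as leaves and, for each merge of $X,Y$, a node $X\cup Y$ with children $X,Y$. The merge tree is the dendrogram without its leaves (each node is a merge). A sequence of merges is consistent with the merge tree if each merge appears after its children merges. In the current contracted graph, $w_{\max}(v)$ is the maximum weight of an edge incident to $v$ (0 if none); $M(v)=\infty$ for singletons and $M(u\cup v)=\min(M(u),M(v),w(u,v))$ when $u,v$ are merged. A merge of adjacent $u,v$ in the current graph is $(1+\epsilon)$-good if $\frac{\max(w_{\max}(u),w_{\max}(v))}{\min(M(u),M(v),w(u,v))}\le 1+\epsilon$. A merge of $X,Y$ in a contracted graph $H$ is $(1+\epsilon)$-approximate if $(1+\epsilon)w(X,Y)\ge$ the maximum edge weight of $H$. $D$ is $(1+\epsilon)$-approximate if there is a sequence of all merges of $D$, consistent with its merge tree, in which every merge is $(1+\epsilon)$-approximate with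 respect to the graph obtained by applying the preceding merges, and after which no pair of clusters has nonzero similarity.
   Formalization: The edge weights and the parameter $\epsilon$ are rational. -}

module Defs where

open import Data.Nat using (ℕ; zero; suc) renaming (_*_ to _*ℕ_; _<_ to _<ℕ_)
open import Data.Integer using (+_)
open import Data.Rational using (ℚ; 0ℚ; 1ℚ; _+_; _*_; _≤_; _<_; _⊔_; _⊓_; _/_)
open import Data.Bool using (Bool; true; false; _∧_; if_then_else_)
open import Data.Fin using (Fin; toℕ)
open import Data.Fin.Subset using (Subset; _∪_; ⁅_⁆; ∣_∣)
open import Data.Vec using (lookup)
open import Data.List using (List; []; _∷_; map; foldr; length; allFin)
  renaming (lookup to lookupL)
open import Data.List.Relation.Binary.Permutation.Propositional using (_↭_)
open import Data.List.Relation.Binary.Permutation.Homogeneous using (Permutation)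
open import Data.Product using (_×_; _,_; proj₁; proj₂; Σ; ∃)
open import Data.Sum using (_⊎_)
open import Relation.Binary.PropositionalEquality using (_≡_)

-- Weighted undirected graphs on vertex set Fin n, weights in ℚ.
-- w x y is the weight of edge xy; xy is an edge iff 0 < w x y.

record WGraph (n : ℕ) : Set where
  field
    w      : Fin n → Fin n → ℚ
    symm   : ∀ x y → w x y ≡ w y x
    nonneg : ∀ x y → 0ℚ ≤ w x y
    noLoop : ∀ x → w x x ≡ 0ℚ
open WGraph public

Cluster : ℕ → Set
Cluster n = Subset n

Σℚ : ∀ {n} → (Fin n → ℚ) → ℚ
Σℚ {n} f = foldr _+_ 0ℚ (map f (allFin n))

-- 1/k for k ≥ 1 (and 0 for k = 0, a case that never arises for nonempty clusters)
inv : ℕ → ℚ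
inv zero    = 0ℚ
inv (suc k) = + 1 / suc k

wC : ∀ {n} → WGraph n → Cluster n → Cluster n → ℚ
wC G X Y =
  inv (∣ X ∣ *ℕ ∣ Y ∣) *
  Σℚ (λ x → Σℚ (λ y → if lookup X x ∧ lookup Y y then w G x y else 0ℚ))

Partition : ℕ → Set
Partition n = List (Cluster n)

singletons : ∀ n → Partition n
singletons n = map ⁅_⁆ (allFin n)

-- A merge is the (unordered) pair of clusters X,Y; it creates node X ∪ Y.
Merge : ℕ → Set
Merge n = Cluster n × Cluster n

node : ∀ {n} → Merge n → Cluster n
node (X , Y) = X ∪ Y

SameMerge : ∀ {n} → Merge n → Merge n → Set
SameMerge (X , Y) (X' , Y') = (X ≡ X' × Y ≡ Y') ⊎ (X ≡ Y' × Y ≡ X')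

-- Maximum edge weight of the contracted graph H of partition P is at most q:
-- every pair of distinct clusters of P has similarity ≤ q.
MaxWeight≤ : ∀ {n} → WGraph n → Partition n → ℚ → Set
MaxWeight≤ G P q = ∀ C C' R → P ↭ (C ∷ C' ∷ R) → wC G C C' ≤ q

Terminal : ∀ {n} → WGraph n → Partition n → Set
Terminal G P = ∀ C C' R → P ↭ (C ∷ C' ∷ R) → wC G C C' ≡ 0ℚ

onePlus : ℚ → ℚ
onePlus ε = 1ℚ + ε

ApproxMerge : ∀ {n} → WGraph n → ℚ → Partition n → Merge n → Set
ApproxMerge G ε P (X , Y) = MaxWeight≤ G P (onePlus ε * wC G X Y)

data ApproxSeq {n} (G : WGraph n) (ε : ℚ) : Partition n → List (Merge n) → Partition n → Set where
  done : ∀ {P} → ApproxSeq G ε P [] P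
  step : ∀ {P X Y R ms P'} →
         P ↭ (X ∷ Y ∷ R) →
         ApproxMerge G ε P (X , Y) →
         ApproxSeq G ε ((X ∪ Y) ∷ R) ms P' →
         ApproxSeq G ε P ((X , Y) ∷ ms) P'

ConsistentWithTree : ∀ {n} → List (Merge n) → Set
ConsistentWithTree ms = ∀ (i j : Fin (length ms)) →
  (node (lookupL ms j) ≡ proj₁ (lookupL ms i) ⊎ node (lookupL ms j) ≡ proj₂ (lookupL ms i)) →
  toℕ j <ℕ toℕ i

IsApproxDendrogram : ∀ {n} → WGraph n → ℚ → List (Merge n) → Set
IsApproxDendrogram {n} G ε D =
  Σ (List (Merge n)) λ ms →
    Permutation SameMerge D ms ×
    ConsistentWithTree ms ×
    Σ (Partition n) λ P → ApproxSeq G ε (singletons n) ms P × Terminal G P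

data ℚ∞ : Set where
  fin : ℚ → ℚ∞
  ∞   : ℚ∞

min∞ : ℚ∞ → ℚ∞ → ℚ∞
min∞ ∞ b = b
min∞ a ∞ = a
min∞ (fin a) (fin b) = fin (a ⊓ b)

minFin : ℚ∞ → ℚ → ℚ
minFin ∞ q = q
minFin (fin a) q = a ⊓ q

-- state of a run: current clusters together with their M-values
State : ℕ → Set
State n = List (Cluster n × ℚ∞)

clusters : ∀ {n} → State n → Partition n
clusters = map proj₁

initState : ∀ n → State n
initState n = map (λ i → (⁅ i ⁆ , ∞)) (allFin n)

-- w_max(C) in the contracted graph of P, where P ↭ C ∷ R: max over R, 0 if none
wmax : ∀ {n} → WGraph n → Cluster n → Partition n → ℚ
wmax G C R = foldr _⊔_ 0ℚ (map (wC G C) R)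

-- (1+ε)-good merge of u = (X,MX), v = (Y,MY) in state s with s ↭ u ∷ v ∷ R:
-- max(w_max(u), w_max(v)) / min(M(u), M(v), w(u,v)) ≤ 1+ε
-- (stated multiplicatively; the denominator is positive since w(u,v) > 0)
GoodMerge : ∀ {n} → WGraph n → ℚ → Cluster n × ℚ∞ → Cluster n × ℚ∞ → State n → Set
GoodMerge G ε (X , MX) (Y , MY) R =
  (wmax G X (Y ∷ clusters R) ⊔ wmax G Y (X ∷ clusters R))
    ≤ onePlus ε * minFin (min∞ MX MY) (wC G X Y)

data GoodRun {n} (G : WGraph n) (ε : ℚ) : State n → List (Merge n) → State n → Set where
  done : ∀ {s} → GoodRun G ε s [] s
  step : ∀ {s X MX Y MY R ms s'} →
         s ↭ ((X , MX) ∷ (Y , MY) ∷ R) →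
         0ℚ < wC G X Y →
         GoodMerge G ε (X , MX) (Y , MY) R →
         GoodRun G ε ((X ∪ Y , fin (minFin (min∞ MX MY) (wC G X Y))) ∷ R) ms s' →
         GoodRun G ε s ((X , Y) ∷ ms) s'

GoodHACDendrogram : ∀ {n} → WGraph n → ℚ → List (Merge n) → Set
GoodHACDendrogram {n} G ε D =
  Σ (State n) λ s → GoodRun G ε (initState n) D s × Terminal G (clusters s)

module Submission where

-- Call min(M(u), M(v), w(u,v)), the M-value of the cluster created by merging u and v, the
-- level of that merge.  We reorder the merges of the run, from its last merge backwards:
-- a merge of X and Y of level M₀ is inserted into the already reordered tail just before
-- the first merge of level at most M₀.  The merges it is moved past have higher level, so
-- none of them involves X ∪ Y (a merge involving a cluster has level at most its M-value),
-- and goodness bounds the similarity of X and of Y to every other cluster by (1+ε)M₀, hence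
-- also to every union of other clusters, similarity to a union being an average.  This
-- preserves the invariant that at every merge all similarities are at most (1+ε) times the
-- level of the merge, which is at most the similarity of the merged pair.  Consistency with
-- the merge tree holds for any sequence of merges of disjoint nonempty clusters: the node of
-- a merge is a union of current clusters, so it cannot be a cluster that was merged before.

open import Defs
open import Algebra.Bundles using (CommutativeMonoid)
open import Data.Bool using (true; false; _∧_; _∨_; if_then_else_)
open import Data.Empty using (⊥-elim)
open import Data.Fin using (Fin; zero; suc)
open import Data.Fin.Subset using (Subset; _∈_; _∉_; _⊆_; Nonempty; _∪_; ⁅_⁆; ∣_∣)
open import Data.Fin.Subset.Properties using (p⊆p∪q; q⊆p∪q; x∈p∪q⁻; x∈⁅x⁆; x∈⁅y⁆⇒x≡y)
import Data.Integer as ℤ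
import Data.Integer.Properties as ℤ
open import Data.List using (List; []; _∷_; _++_; map; foldr; allFin)
open import Data.List.Membership.Propositional using () renaming (_∈_ to _∈ₗ_)
open import Data.List.Membership.Propositional.Properties using (∈-∃++; ∈-lookup)
open import Data.List.Properties using (map-∘)
open import Data.List.Relation.Unary.All as All using (All; []; _∷_)
open import Data.List.Relation.Unary.AllPairs as AllPairs using (AllPairs; []; _∷_)
import Data.List.Relation.Unary.AllPairs.Properties as AllPairsₚ
import Data.List.Relation.Unary.All.Properties as Allₚ
open import Data.List.Relation.Unary.Any using (here; there)
open import Data.List.Relation.Unary.Unique.Propositional.Properties using (allFin⁺)
open import Data.List.Relation.Binary.Permutation.Propositional
  using (_↭_; ↭-refl; ↭-sym; ↭-trans; prep; swap; ↭⇒↭ₛ′)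
open import Data.List.Relation.Binary.Permutation.Propositional.Properties
  using (All-resp-↭; ∈-resp-↭; map⁺; shift; shifts; drop-∷)
import Data.List.Relation.Binary.Permutation.Setoid.Properties as Permutationₛ
import Data.List.Relation.Binary.Permutation.Homogeneous as Homogeneous
open import Data.Nat as ℕ using (ℕ; suc; s≤s; z≤n)
import Data.Nat.Properties as ℕ
open import Data.Product using (_×_; _,_; proj₁; proj₂; ∃; ∃₂)
open import Data.Rational using (ℚ; 0ℚ; 1ℚ; _+_; _*_; _≤_; _≰_; _<_; _⊓_; _/_; toℚᵘ; NonNegative; nonNegative)
open import Data.Rational.Properties
open import Algebra.Properties.CommutativeSemigroup
  (CommutativeMonoid.commutativeSemigroup +-0-commutativeMonoid) using (interchange)
import Data.Rational.Unnormalised as ℚᵘ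
import Data.Rational.Unnormalised.Properties as ℚᵘ
open import Data.Sum using (_⊎_; inj₁; inj₂)
open import Data.Vec using ([]; _∷_; lookup; here; there)
open import Data.Vec.Properties using (lookup-zipWith; lookup⇒[]=)
open import Function using (const; _∘_)
open import Relation.Binary.Core using (Rel; _⇒_)
open import Relation.Binary.Definitions using (Symmetric; _Respects_)
open import Relation.Binary.PropositionalEquality as ≡
  using (_≡_; _≢_; refl; sym; trans; cong; cong₂; subst)
open import Relation.Nullary using (¬_; yes; no)

module _ {a} {A : Set a} where

  ∈⇒↭ : ∀ {x : A} {xs} → x ∈ₗ xs → ∃ λ ys → xs ↭ x ∷ ys
  ∈⇒↭ {x} x∈xs with ys , zs , refl ← ∈-∃++ x∈xs = ys ++ zs , shift x ys zs

  ↭-∷-avoiding : ∀ {x y z : A} {xs ys} → x ∷ xs ↭ y ∷ z ∷ ys → x ≢ y → x ≢ z →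
    ∃ λ zs → xs ↭ y ∷ z ∷ zs × ys ↭ x ∷ zs
  ↭-∷-avoiding {x} {y} {z} x∷xs↭ x≢y x≢z with ∈-resp-↭ x∷xs↭ (here refl)
  ... | here x≡y          = ⊥-elim (x≢y x≡y)
  ... | there (here x≡z)  = ⊥-elim (x≢z x≡z)
  ... | there (there x∈ys) with zs , ys↭ ← ∈⇒↭ x∈ys =
    zs , drop-∷ (↭-trans x∷xs↭ (↭-trans (prep y (prep z ys↭)) (shift x (y ∷ z ∷ []) zs))) , ys↭

  AllPairs-resp-↭ : ∀ {r} {R : Rel A r} → Symmetric R → (AllPairs R) Respects _↭_
  AllPairs-resp-↭ {R = R} R-sym xs↭ys =
    Permutationₛ.AllPairs-resp-↭ (≡.setoid A) R-sym (≡.resp₂ R) (↭⇒↭ₛ′ ≡.isEquivalence xs↭ys)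

  ↭⇒Permutation : ∀ {r} {R : Rel A r} → _≡_ ⇒ R → _↭_ ⇒ Homogeneous.Permutation R
  ↭⇒Permutation ≡⇒R xs↭ys = Homogeneous.map ≡⇒R (↭⇒↭ₛ′ ≡.isEquivalence xs↭ys)

-- Sums and averages of rationals

sumOver : ∀ {a} {A : Set a} → List A → (A → ℚ) → ℚ
sumOver xs f = foldr _+_ 0ℚ (map f xs)

module _ {a} {A : Set a} where

  sumOver-cong : ∀ xs {f g : A → ℚ} → (∀ x → f x ≡ g x) → sumOver xs f ≡ sumOver xs g
  sumOver-cong []       _   = refl
  sumOver-cong (x ∷ xs) f≗g = cong₂ _+_ (f≗g x) (sumOver-cong xs f≗g)

  sumOver-zero : ∀ (xs : List A) → sumOver xs (const 0ℚ) ≡ 0ℚ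
  sumOver-zero []       = refl
  sumOver-zero (x ∷ xs) = trans (+-identityˡ _) (sumOver-zero xs)

  sumOver-+ : ∀ xs (f g : A → ℚ) → sumOver xs (λ x → f x + g x) ≡ sumOver xs f + sumOver xs g
  sumOver-+ []       f g = refl
  sumOver-+ (x ∷ xs) f g =
    trans (cong ((f x + g x) +_) (sumOver-+ xs f g)) (interchange (f x) (g x) _ _)

sumOver-comm : ∀ {a b} {A : Set a} {B : Set b} xs ys (f : A → B → ℚ) →
  sumOver xs (λ x → sumOver ys (f x)) ≡ sumOver ys (λ y → sumOver xs (λ x → f x y))
sumOver-comm []       ys f = sym (sumOver-zero ys)
sumOver-comm (x ∷ xs) ys f =
  trans (cong (sumOver ys (f x) +_) (sumOver-comm xs ys f)) (sym (sumOver-+ ys (f x) _))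

fromℕ : ℕ → ℚ
fromℕ m = ℤ.+ m / 1

toℚᵘ-fromℕ : ∀ m → toℚᵘ (fromℕ m) ℚᵘ.≃ ℚᵘ.mkℚᵘ (ℤ.+ m) 0
toℚᵘ-fromℕ m = toℚᵘ-fromℚᵘ (ℚᵘ.mkℚᵘ (ℤ.+ m) 0)

fromℕ-+ : ∀ m k → fromℕ (m ℕ.+ k) ≡ fromℕ m + fromℕ k
fromℕ-+ m k = toℚᵘ-injective (begin
  toℚᵘ (fromℕ (m ℕ.+ k))                       ≈⟨ toℚᵘ-fromℕ (m ℕ.+ k) ⟩
  ℚᵘ.mkℚᵘ (ℤ.+ (m ℕ.+ k)) 0                    ≈⟨ ℚᵘ.*≡* (cong (ℤ._* ℤ.+ 1) ℤ-+) ⟩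
  ℚᵘ.mkℚᵘ (ℤ.+ m) 0 ℚᵘ.+ ℚᵘ.mkℚᵘ (ℤ.+ k) 0      ≈⟨ ℚᵘ.+-cong (toℚᵘ-fromℕ m) (toℚᵘ-fromℕ k) ⟨
  toℚᵘ (fromℕ m) ℚᵘ.+ toℚᵘ (fromℕ k)            ≈⟨ toℚᵘ-homo-+ (fromℕ m) (fromℕ k) ⟨
  toℚᵘ (fromℕ m + fromℕ k)                     ∎)
  where
  open import Relation.Binary.Reasoning.Setoid ℚᵘ.≃-setoid
  ℤ-+ : ℤ.+ (m ℕ.+ k) ≡ ℤ.+ m ℤ.* ℤ.+ 1 ℤ.+ ℤ.+ k ℤ.* ℤ.+ 1
  ℤ-+ = trans (ℤ.pos-+ m k) (sym (cong₂ ℤ._+_ (ℤ.*-identityʳ (ℤ.+ m)) (ℤ.*-identityʳ (ℤ.+ k))))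

inv*fromℕ≡1 : ∀ k → inv (suc k) * fromℕ (suc k) ≡ 1ℚ
inv*fromℕ≡1 k = toℚᵘ-injective (begin
  toℚᵘ (inv (suc k) * fromℕ (suc k))                   ≈⟨ toℚᵘ-homo-* (inv (suc k)) (fromℕ (suc k)) ⟩
  toℚᵘ (inv (suc k)) ℚᵘ.* toℚᵘ (fromℕ (suc k))         ≈⟨ ℚᵘ.*-cong (toℚᵘ-fromℚᵘ (ℚᵘ.mkℚᵘ (ℤ.+ 1) k)) (toℚᵘ-fromℕ (suc k)) ⟩
  ℚᵘ.1/ ℚᵘ.mkℚᵘ (ℤ.+ suc k) 0 ℚᵘ.* ℚᵘ.mkℚᵘ (ℤ.+ suc k) 0 ≈⟨ ℚᵘ.*-inverseˡ (ℚᵘ.mkℚᵘ (ℤ.+ suc k) 0) ⟩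
  ℚᵘ.1ℚᵘ                                              ∎)
  where open import Relation.Binary.Reasoning.Setoid ℚᵘ.≃-setoid

fromℕ*inv*-cancel : ∀ k p → fromℕ (suc k) * (inv (suc k) * p) ≡ p
fromℕ*inv*-cancel k p = begin
  fromℕ (suc k) * (inv (suc k) * p)   ≡⟨ *-assoc (fromℕ (suc k)) (inv (suc k)) p ⟨
  fromℕ (suc k) * inv (suc k) * p     ≡⟨ cong (_* p) (*-comm (fromℕ (suc k)) (inv (suc k))) ⟩
  inv (suc k) * fromℕ (suc k) * p     ≡⟨ cong (_* p) (inv*fromℕ≡1 k) ⟩
  1ℚ * p                              ≡⟨ *-identityˡ p ⟩
  p                                   ∎
  where open ≡.≡-Reasoning

inv*fromℕ*-cancel : ∀ k p → inv (suc k) * (fromℕ (suc k) * p) ≡ p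
inv*fromℕ*-cancel k p = begin
  inv (suc k) * (fromℕ (suc k) * p)   ≡⟨ *-assoc (inv (suc k)) (fromℕ (suc k)) p ⟨
  inv (suc k) * fromℕ (suc k) * p     ≡⟨ cong (_* p) (inv*fromℕ≡1 k) ⟩
  1ℚ * p                              ≡⟨ *-identityˡ p ⟩
  p                                   ∎
  where open ≡.≡-Reasoning

inv*≤⇒≤fromℕ* : ∀ k {p q} → inv (suc k) * p ≤ q → p ≤ fromℕ (suc k) * q
inv*≤⇒≤fromℕ* k {p} {q} = subst (_≤ fromℕ (suc k) * q) (fromℕ*inv*-cancel k p)
  ∘ *-monoˡ-≤-nonNeg (fromℕ (suc k)) {{normalize-nonNeg (suc k) 1}} {inv (suc k) * p} {q}

≤fromℕ*⇒inv*≤ : ∀ k {p q} → p ≤ fromℕ (suc k) * q → inv (suc k) * p ≤ q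
≤fromℕ*⇒inv*≤ k {p} {q} = subst (inv (suc k) * p ≤_) (inv*fromℕ*-cancel k q)
  ∘ *-monoˡ-≤-nonNeg (inv (suc k)) {{normalize-nonNeg 1 (suc k)}} {p} {fromℕ (suc k) * q}

mean-+-≤ : ∀ j k {S T b} → inv (suc j) * S ≤ b → inv (suc k) * T ≤ b →
  inv (suc j ℕ.+ suc k) * (S + T) ≤ b
mean-+-≤ j k {S} {T} {b} S≤ T≤ = ≤fromℕ*⇒inv*≤ (j ℕ.+ suc k) (begin
  S + T                                   ≤⟨ +-mono-≤ (inv*≤⇒≤fromℕ* j S≤) (inv*≤⇒≤fromℕ* k T≤) ⟩
  fromℕ (suc j) * b + fromℕ (suc k) * b   ≡⟨ *-distribʳ-+ b (fromℕ (suc j)) (fromℕ (suc k)) ⟨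
  (fromℕ (suc j) + fromℕ (suc k)) * b     ≡⟨ cong (_* b) (fromℕ-+ (suc j) (suc k)) ⟨
  fromℕ (suc j ℕ.+ suc k) * b             ∎)
  where open ≤-Reasoning

-- Similarity of clusters

record Disjoint {n} (p q : Subset n) : Set where
  constructor disjoint
  field ∉ʳ : ∀ {x} → x ∈ p → x ∉ q
open Disjoint

Disjoint-sym : ∀ {n} {p q : Subset n} → Disjoint p q → Disjoint q p
Disjoint-sym p#q = disjoint λ x∈q x∈p → ∉ʳ p#q x∈p x∈q

Disjoint-⊆ˡ : ∀ {n} {p q r : Subset n} → p ⊆ q → Disjoint q r → Disjoint p r
Disjoint-⊆ˡ p⊆q q#r = disjoint (∉ʳ q#r ∘ p⊆q)

Disjoint-∪ˡ : ∀ {n} {p q r : Subset n} → Disjoint p r → Disjoint q r → Disjoint (p ∪ q) r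
Disjoint-∪ˡ {p = p} {q} {r} p#r q#r = disjoint λ x∈p∪q → case (x∈p∪q⁻ p q x∈p∪q)
  where
  case : ∀ {x} → x ∈ p ⊎ x ∈ q → x ∉ r
  case (inj₁ x∈p) = ∉ʳ p#r x∈p
  case (inj₂ x∈q) = ∉ʳ q#r x∈q

Nonempty⇒¬Disjoint-⊆ : ∀ {n} {p q : Subset n} → Nonempty p → p ⊆ q → ¬ Disjoint p q
Nonempty⇒¬Disjoint-⊆ (x , x∈p) p⊆q p#q = ∉ʳ p#q x∈p (p⊆q x∈p)

Disjoint-⁅⁆ : ∀ {n} {i j : Fin n} → i ≢ j → Disjoint ⁅ i ⁆ ⁅ j ⁆
Disjoint-⁅⁆ {i = i} {j} i≢j =
  disjoint λ x∈i x∈j → i≢j (trans (sym (x∈⁅y⁆⇒x≡y i x∈i)) (x∈⁅y⁆⇒x≡y j x∈j))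

Disjoint-tail : ∀ {n a b} {p q : Subset n} → Disjoint (a ∷ p) (b ∷ q) → Disjoint p q
Disjoint-tail p#q = disjoint λ x∈p x∈q → ∉ʳ p#q (there x∈p) (there x∈q)

∣p∪q∣≡∣p∣+∣q∣ : ∀ {n} (p q : Subset n) → Disjoint p q → ∣ p ∪ q ∣ ≡ ∣ p ∣ ℕ.+ ∣ q ∣
∣p∪q∣≡∣p∣+∣q∣ []            []            _   = refl
∣p∪q∣≡∣p∣+∣q∣ (true ∷ p)    (true ∷ q)    p#q = ⊥-elim (∉ʳ p#q here here)
∣p∪q∣≡∣p∣+∣q∣ (true ∷ p)    (false ∷ q)   p#q = cong suc (∣p∪q∣≡∣p∣+∣q∣ p q (Disjoint-tail p#q))
∣p∪q∣≡∣p∣+∣q∣ (false ∷ p)   (true ∷ q)    p#q =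
  trans (cong suc (∣p∪q∣≡∣p∣+∣q∣ p q (Disjoint-tail p#q))) (sym (ℕ.+-suc ∣ p ∣ ∣ q ∣))
∣p∪q∣≡∣p∣+∣q∣ (false ∷ p)   (false ∷ q)   p#q = ∣p∪q∣≡∣p∣+∣q∣ p q (Disjoint-tail p#q)

Nonempty⇒∣p∣≡suc : ∀ {n} (p : Subset n) → Nonempty p → ∃ λ k → ∣ p ∣ ≡ suc k
Nonempty⇒∣p∣≡suc (true ∷ p)  _               = ∣ p ∣ , refl
Nonempty⇒∣p∣≡suc (false ∷ p) (suc x , there x∈p) = Nonempty⇒∣p∣≡suc p (x , x∈p)

module _ {n} (G : WGraph n) where

  edgeWeightIn : Cluster n → Cluster n → Fin n → Fin n → ℚ
  edgeWeightIn X Y x y = if lookup X x ∧ lookup Y y then w G x y else 0ℚ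

  crossWeight : Cluster n → Cluster n → ℚ
  crossWeight X Y = Σℚ (λ x → Σℚ (edgeWeightIn X Y x))

  edgeWeightIn-sym : ∀ X Y x y → edgeWeightIn X Y x y ≡ edgeWeightIn Y X y x
  edgeWeightIn-sym X Y x y with lookup X x | lookup Y y
  ... | true  | true  = symm G x y
  ... | true  | false = refl
  ... | false | true  = refl
  ... | false | false = refl

  crossWeight-sym : ∀ X Y → crossWeight X Y ≡ crossWeight Y X
  crossWeight-sym X Y = trans (sumOver-comm (allFin n) (allFin n) (edgeWeightIn X Y))
    (sumOver-cong (allFin n) λ y → sumOver-cong (allFin n) λ x → edgeWeightIn-sym X Y x y)

  wC-sym : ∀ X Y → wC G X Y ≡ wC G Y X
  wC-sym X Y = cong₂ (λ k S → inv k * S) (ℕ.*-comm ∣ X ∣ ∣ Y ∣) (crossWeight-sym X Y)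

  edgeWeightIn-∪ʳ : ∀ X {A B} → Disjoint A B → ∀ x y →
    edgeWeightIn X (A ∪ B) x y ≡ edgeWeightIn X A x y + edgeWeightIn X B x y
  edgeWeightIn-∪ʳ X {A} {B} A#B x y rewrite lookup-zipWith _∨_ y A B
    with lookup X x | lookup A y in y∈A | lookup B y in y∈B
  ... | false | _     | _     = refl
  ... | true  | true  | true  = ⊥-elim (∉ʳ A#B (lookup⇒[]= y A y∈A) (lookup⇒[]= y B y∈B))
  ... | true  | true  | false = sym (+-identityʳ _)
  ... | true  | false | true  = sym (+-identityˡ _)
  ... | true  | false | false = refl

  crossWeight-∪ʳ : ∀ X {A B} → Disjoint A B → crossWeight X (A ∪ B) ≡ crossWeight X A + crossWeight X B
  crossWeight-∪ʳ X A#B = trans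
    (sumOver-cong (allFin n) λ x →
      trans (sumOver-cong (allFin n) (edgeWeightIn-∪ʳ X A#B x)) (sumOver-+ (allFin n) _ _))
    (sumOver-+ (allFin n) _ _)

  wC-∪ʳ-≤ : ∀ {X A B b} → Nonempty X → Nonempty A → Nonempty B → Disjoint A B →
    wC G X A ≤ b → wC G X B ≤ b → wC G X (A ∪ B) ≤ b
  wC-∪ʳ-≤ {X} {A} {B} {b} neX neA neB A#B XA≤b XB≤b
    with x , ∣X∣≡ ← Nonempty⇒∣p∣≡suc X neX
       | a , ∣A∣≡ ← Nonempty⇒∣p∣≡suc A neA
       | c , ∣B∣≡ ← Nonempty⇒∣p∣≡suc B neB = begin
    wC G X (A ∪ B)
      ≡⟨ cong₂ (λ k S → inv k * S) size (crossWeight-∪ʳ X A#B) ⟩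
    inv (suc x ℕ.* suc a ℕ.+ suc x ℕ.* suc c) * (crossWeight X A + crossWeight X B)
      ≤⟨ mean-+-≤ (a ℕ.+ x ℕ.* suc a) (c ℕ.+ x ℕ.* suc c) (resize {A} ∣A∣≡ XA≤b) (resize {B} ∣B∣≡ XB≤b) ⟩
    b ∎
    where
    open ≤-Reasoning
    size : ∣ X ∣ ℕ.* ∣ A ∪ B ∣ ≡ suc x ℕ.* suc a ℕ.+ suc x ℕ.* suc c
    size = trans (cong₂ ℕ._*_ ∣X∣≡ (trans (∣p∪q∣≡∣p∣+∣q∣ A B A#B) (cong₂ ℕ._+_ ∣A∣≡ ∣B∣≡)))
      (ℕ.*-distribˡ-+ (suc x) (suc a) (suc c))
    resize : ∀ {C k} → ∣ C ∣ ≡ suc k → wC G X C ≤ b → inv (suc x ℕ.* suc k) * crossWeight X C ≤ b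
    resize {C} ∣C∣≡ = subst (λ m → inv m * crossWeight X C ≤ b) (cong₂ ℕ._*_ ∣X∣≡ ∣C∣≡)

module _ {n} (G : WGraph n) where

  WeightAtMost : ℚ → Cluster n → Cluster n → Set
  WeightAtMost q C C' = wC G C C' ≤ q

  WeightAtMost-sym : ∀ {q} → Symmetric (WeightAtMost q)
  WeightAtMost-sym {q} {C} {C'} = subst (_≤ q) (wC-sym G C C')

  AllPairs⇒MaxWeight≤ : ∀ {P q} → AllPairs (WeightAtMost q) P → MaxWeight≤ G P q
  AllPairs⇒MaxWeight≤ {q = q} pairs C C' R P↭
    with AllPairs-resp-↭ (λ {C₁} {C₂} → WeightAtMost-sym {q} {C₁} {C₂}) P↭ pairs
  ... | (CC'≤q ∷ _) ∷ _ = CC'≤q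

  MaxWeight≤-resp-↭ : ∀ {P P' q} → P ↭ P' → MaxWeight≤ G P q → MaxWeight≤ G P' q
  MaxWeight≤-resp-↭ P↭P' bound C C' R P'↭ = bound C C' R (↭-trans P↭P' P'↭)

  MaxWeight≤-tail : ∀ {C P q} → MaxWeight≤ G (C ∷ P) q → MaxWeight≤ G P q
  MaxWeight≤-tail {C} bound C₁ C₂ R P↭ =
    bound C₁ C₂ (C ∷ R) (↭-trans (prep C P↭) (↭-sym (shift C (C₁ ∷ C₂ ∷ []) R)))

  MaxWeight≤⇒AllPairs : ∀ {P q} → MaxWeight≤ G P q → AllPairs (WeightAtMost q) P
  MaxWeight≤⇒AllPairs {[]}    bound = []
  MaxWeight≤⇒AllPairs {C ∷ P} bound =
    All.tabulate (λ C'∈P → let R , P↭ = ∈⇒↭ C'∈P in bound C _ R (prep C P↭))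
    ∷ MaxWeight≤⇒AllPairs (MaxWeight≤-tail bound)

  MaxWeight≤-mono : ∀ {P q q'} → q ≤ q' → MaxWeight≤ G P q → MaxWeight≤ G P q'
  MaxWeight≤-mono q≤q' bound C C' R P↭ = ≤-trans (bound C C' R P↭) q≤q'

  Terminal⇒MaxWeight≤ : ∀ {P q} → 0ℚ ≤ q → Terminal G P → MaxWeight≤ G P q
  Terminal⇒MaxWeight≤ 0≤q terminal C C' R P↭ = subst (_≤ _) (sym (terminal C C' R P↭)) 0≤q

  Terminal-resp-↭ : ∀ {P P'} → P ↭ P' → Terminal G P → Terminal G P'
  Terminal-resp-↭ P↭P' terminal C C' R P'↭ = terminal C C' R (↭-trans P↭P' P'↭)

  wmax-upper : ∀ X {C L} → C ∈ₗ L → wC G X C ≤ wmax G X L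
  wmax-upper X (here refl)         = p≤p⊔q _ _
  wmax-upper X {L = D ∷ L} (there C∈L) = p≤q⇒p≤r⊔q (wC G X D) (wmax-upper X C∈L)

  wmax-nonNeg : ∀ X L → 0ℚ ≤ wmax G X L
  wmax-nonNeg X []      = ≤-refl
  wmax-nonNeg X (D ∷ L) = p≤q⇒p≤r⊔q (wC G X D) (wmax-nonNeg X L)

WellFormed : ∀ {n} → Partition n → Set
WellFormed P = AllPairs Disjoint P × All Nonempty P

WellFormed-resp-↭ : ∀ {n} {P P' : Partition n} → P ↭ P' → WellFormed P → WellFormed P'
WellFormed-resp-↭ P↭P' (disj , ne) = AllPairs-resp-↭ Disjoint-sym P↭P' disj , All-resp-↭ P↭P' ne

WellFormed-merge : ∀ {n} {X Y : Cluster n} {P} → WellFormed (X ∷ Y ∷ P) → WellFormed (X ∪ Y ∷ P)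
WellFormed-merge {X = X} {Y} ((_ ∷ X#P) ∷ Y#P ∷ disj , (x , x∈X) ∷ _ ∷ ne) =
  All.zipWith (λ (X#C , Y#C) → Disjoint-∪ˡ X#C Y#C) (X#P , Y#P) ∷ disj , (x , p⊆p∪q Y x∈X) ∷ ne

WellFormed-singletons : ∀ n → WellFormed (singletons n)
WellFormed-singletons n =
  AllPairsₚ.map⁺ (AllPairs.map Disjoint-⁅⁆ (allFin⁺ n)) ,
  Allₚ.map⁺ (All.universal (λ i → i , x∈⁅x⁆ i) (allFin n))

WellFormed-regroup : ∀ {n} {X Y A B : Cluster n} {P Q} →
  WellFormed (X ∷ Y ∷ P) → P ↭ A ∷ B ∷ Q → WellFormed (X ∷ Y ∷ A ∪ B ∷ Q)
WellFormed-regroup {X = X} {Y} {A} {B} {Q = Q} wf P↭ =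
  WellFormed-resp-↭ (↭-sym (shift (A ∪ B) (X ∷ Y ∷ []) Q))
    (WellFormed-merge (WellFormed-resp-↭ (↭-trans (prep X (prep Y P↭)) (shifts (X ∷ Y ∷ []) (A ∷ B ∷ []))) wf))

-- Consistency with the merge tree

Saturated : ∀ {n} → Partition n → Cluster n → Set
Saturated P N = All (λ C → C ⊆ N ⊎ Disjoint C N) P

module _ {n} {X Y : Cluster n} where

  Saturated-split : ∀ {P N} → Saturated (X ∪ Y ∷ P) N → Saturated (X ∷ Y ∷ P) N
  Saturated-split (inj₁ X∪Y⊆N ∷ sat) = inj₁ (X∪Y⊆N ∘ p⊆p∪q Y) ∷ inj₁ (X∪Y⊆N ∘ q⊆p∪q X Y) ∷ sat
  Saturated-split (inj₂ X∪Y#N ∷ sat) =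
    inj₂ (Disjoint-⊆ˡ (p⊆p∪q Y) X∪Y#N) ∷ inj₂ (Disjoint-⊆ˡ (q⊆p∪q X Y) X∪Y#N) ∷ sat

  Saturated-∪ : ∀ {P} → AllPairs Disjoint (X ∷ Y ∷ P) → Saturated (X ∪ Y ∷ P) (X ∪ Y)
  Saturated-∪ ((_ ∷ X#P) ∷ Y#P ∷ _) =
    inj₁ (λ x∈X∪Y → x∈X∪Y) ∷
    All.zipWith (λ (X#C , Y#C) → inj₂ (Disjoint-sym (Disjoint-∪ˡ X#C Y#C))) (X#P , Y#P)

  Saturated-∪⇒≢ : ∀ {P N} → WellFormed (X ∷ Y ∷ P) → Saturated (X ∪ Y ∷ P) N → ¬ (N ≡ X ⊎ N ≡ Y)
  Saturated-∪⇒≢ ((X#Y ∷ _) ∷ _ , neX ∷ neY ∷ _) (inj₁ X∪Y⊆N ∷ _) (inj₁ refl) =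
    Nonempty⇒¬Disjoint-⊆ neY (X∪Y⊆N ∘ q⊆p∪q X Y) (Disjoint-sym X#Y)
  Saturated-∪⇒≢ ((X#Y ∷ _) ∷ _ , neX ∷ neY ∷ _) (inj₁ X∪Y⊆N ∷ _) (inj₂ refl) =
    Nonempty⇒¬Disjoint-⊆ neX (X∪Y⊆N ∘ p⊆p∪q Y) X#Y
  Saturated-∪⇒≢ (_ , neX ∷ neY ∷ _) (inj₂ X∪Y#N ∷ _) (inj₁ refl) =
    Nonempty⇒¬Disjoint-⊆ neX (p⊆p∪q Y) (Disjoint-sym X∪Y#N)
  Saturated-∪⇒≢ (_ , neX ∷ neY ∷ _) (inj₂ X∪Y#N ∷ _) (inj₂ refl) =
    Nonempty⇒¬Disjoint-⊆ neY (q⊆p∪q X Y) (Disjoint-sym X∪Y#N)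

module _ {n} {G : WGraph n} {ε : ℚ} where

  ApproxSeq-node-Saturated : ∀ {P ms P'} → ApproxSeq G ε P ms P' → WellFormed P →
    All (Saturated P ∘ node) ms
  ApproxSeq-node-Saturated done             _  = []
  ApproxSeq-node-Saturated (step P↭ _ rest) wf =
    All.map (All-resp-↭ (↭-sym P↭) ∘ Saturated-split)
      (Saturated-∪ (proj₁ wf') ∷ ApproxSeq-node-Saturated rest (WellFormed-merge wf'))
    where wf' = WellFormed-resp-↭ P↭ wf

  ApproxSeq⇒ConsistentWithTree : ∀ {P ms P'} → ApproxSeq G ε P ms P' → WellFormed P →
    ConsistentWithTree ms
  ApproxSeq⇒ConsistentWithTree (step P↭ _ rest) wf zero j child =
    ⊥-elim (Saturated-∪⇒≢ wf' (All.lookup saturated (∈-lookup j)) child)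
    where
    wf' = WellFormed-resp-↭ P↭ wf
    saturated = Saturated-∪ (proj₁ wf') ∷ ApproxSeq-node-Saturated rest (WellFormed-merge wf')
  ApproxSeq⇒ConsistentWithTree (step _ _ _) _ (suc i) zero _ = s≤s z≤n
  ApproxSeq⇒ConsistentWithTree (step P↭ _ rest) wf (suc i) (suc j) child =
    s≤s (ApproxSeq⇒ConsistentWithTree rest (WellFormed-merge (WellFormed-resp-↭ P↭ wf)) i j child)

-- Reordering good merges

minFin-min∞-≤ˡ : ∀ a MY w → minFin (min∞ (fin a) MY) w ≤ a
minFin-min∞-≤ˡ a ∞       w = p⊓q≤p a w
minFin-min∞-≤ˡ a (fin b) w = ≤-trans (p⊓q≤p (a ⊓ b) w) (p⊓q≤p a b)

minFin-min∞-≤ʳ : ∀ MX a w → minFin (min∞ MX (fin a)) w ≤ a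
minFin-min∞-≤ʳ ∞       a w = p⊓q≤p a w
minFin-min∞-≤ʳ (fin b) a w = ≤-trans (p⊓q≤p (b ⊓ a) w) (p⊓q≤q b a)

minFin-≤ : ∀ M w → minFin M w ≤ w
minFin-≤ ∞       w = ≤-refl
minFin-≤ (fin a) w = p⊓q≤q a w

module Reordering {n} (G : WGraph n) (ε : ℚ) {{_ : NonNegative (onePlus ε)}} where

  level : Cluster n × ℚ∞ → Cluster n × ℚ∞ → ℚ
  level (X , MX) (Y , MY) = minFin (min∞ MX MY) (wC G X Y)

  merged : Cluster n × ℚ∞ → Cluster n × ℚ∞ → Cluster n × ℚ∞
  merged (X , MX) (Y , MY) = X ∪ Y , fin (level (X , MX) (Y , MY))

  onePlus*-mono-≤ : ∀ {p q} → p ≤ q → onePlus ε * p ≤ onePlus ε * q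
  onePlus*-mono-≤ {p} {q} = *-monoˡ-≤-nonNeg (onePlus ε) {p} {q}

  -- Bounding the similarities by the level rather than by w(X,Y) ≥ level is what makes
  -- this invariant survive moving a merge past merges of higher level.
  data LeveledSeq : State n → List (Merge n) → State n → Set where
    done : ∀ {s s'} → s ↭ s' → LeveledSeq s [] s'
    step : ∀ {s X MX Y MY R ms s'} →
      s ↭ (X , MX) ∷ (Y , MY) ∷ R →
      MaxWeight≤ G (clusters s) (onePlus ε * level (X , MX) (Y , MY)) →
      LeveledSeq (merged (X , MX) (Y , MY) ∷ R) ms s' →
      LeveledSeq s ((X , Y) ∷ ms) s'

  LeveledSeq-resp-↭ : ∀ {s t ms s'} → s ↭ t → LeveledSeq s ms s' → LeveledSeq t ms s'
  LeveledSeq-resp-↭ s↭t (done s↭s')          = done (↭-trans (↭-sym s↭t) s↭s')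
  LeveledSeq-resp-↭ s↭t (step s↭ bound rest) =
    step (↭-trans (↭-sym s↭t) s↭) (MaxWeight≤-resp-↭ G (map⁺ proj₁ s↭t) bound) rest

  LeveledSeq⇒ApproxSeq : ∀ {s ms s'} → LeveledSeq s ms s' →
    ∃ λ P → ApproxSeq G ε (clusters s) ms P × P ↭ clusters s'
  LeveledSeq⇒ApproxSeq {s} (done s↭s') = clusters s , done , map⁺ proj₁ s↭s'
  LeveledSeq⇒ApproxSeq (step {X = X} {MX} {Y} {MY} s↭ bound rest)
    with P , approx , P↭ ← LeveledSeq⇒ApproxSeq rest =
    P , step (map⁺ proj₁ s↭) (MaxWeight≤-mono G (onePlus*-mono-≤ (minFin-≤ (min∞ MX MY) (wC G X Y))) bound) approx , P↭

  module Insertion (X Y : Cluster n) (MX MY : ℚ∞)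
    (XY≤b : wC G X Y ≤ onePlus ε * level (X , MX) (Y , MY))
    (0≤b : 0ℚ ≤ onePlus ε * level (X , MX) (Y , MY)) where

    M₀ : ℚ
    M₀ = level (X , MX) (Y , MY)

    b : ℚ
    b = onePlus ε * M₀

    XY : Cluster n × ℚ∞
    XY = merged (X , MX) (Y , MY)

    Bounded : Cluster n → Set
    Bounded C = wC G X C ≤ b × wC G Y C ≤ b

    extend : ∀ {t T q} → b ≤ q → t ↭ XY ∷ T → MaxWeight≤ G (clusters t) q → All Bounded (clusters T) →
      MaxWeight≤ G (X ∷ Y ∷ clusters T) q
    extend b≤q t↭ bound bounded = AllPairs⇒MaxWeight≤ G
      ( (≤-trans XY≤b b≤q ∷ All.map (λ (XC≤b , _) → ≤-trans XC≤b b≤q) bounded)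
      ∷ All.map (λ (_ , YC≤b) → ≤-trans YC≤b b≤q) bounded
      ∷ MaxWeight≤⇒AllPairs G (MaxWeight≤-tail G (MaxWeight≤-resp-↭ G (map⁺ proj₁ t↭) bound)))

    insert-first : ∀ {t σ s' T} → MaxWeight≤ G (clusters t) b → t ↭ XY ∷ T → All Bounded (clusters T) →
      LeveledSeq t σ s' → LeveledSeq ((X , MX) ∷ (Y , MY) ∷ T) ((X , Y) ∷ σ) s'
    insert-first bound t↭ bounded seq = step ↭-refl (extend ≤-refl t↭ bound bounded) (LeveledSeq-resp-↭ t↭ seq)

    Bounded-regroup : ∀ {P A B Q} → WellFormed (X ∷ Y ∷ P) → P ↭ A ∷ B ∷ Q → All Bounded P →
      All Bounded (A ∪ B ∷ Q)
    Bounded-regroup {A = A} {B} wf P↭ bounded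
      with bA ∷ bB ∷ bQ ← All-resp-↭ P↭ bounded
         | ((A#B ∷ _) ∷ _) , neA ∷ neB ∷ neX ∷ neY ∷ _
             ← WellFormed-resp-↭ (↭-trans (prep X (prep Y P↭)) (shifts (X ∷ Y ∷ []) (A ∷ B ∷ []))) wf =
      ( wC-∪ʳ-≤ G neX neA neB A#B (proj₁ bA) (proj₁ bB)
      , wC-∪ʳ-≤ G neY neA neB A#B (proj₂ bA) (proj₂ bB)) ∷ bQ

    XY≢ˡ : ∀ {u v} → level u v ≰ M₀ → XY ≢ u
    XY≢ˡ {v = B , MB} ≰M₀ refl = ≰M₀ (minFin-min∞-≤ˡ M₀ MB (wC G (X ∪ Y) B))

    XY≢ʳ : ∀ {u v} → level u v ≰ M₀ → XY ≢ v
    XY≢ʳ {u = A , MA} ≰M₀ refl = ≰M₀ (minFin-min∞-≤ʳ MA M₀ (wC G A (X ∪ Y)))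

    insert : ∀ {t σ s' T} → LeveledSeq t σ s' → Terminal G (clusters s') → t ↭ XY ∷ T →
      WellFormed (X ∷ Y ∷ clusters T) → All Bounded (clusters T) →
      ∃₂ λ pre post → σ ≡ pre ++ post × LeveledSeq ((X , MX) ∷ (Y , MY) ∷ T) (pre ++ (X , Y) ∷ post) s'
    insert seq@(done t↭s') terminal t↭ _ bounded =
      [] , [] , refl , insert-first bound t↭ bounded seq
      where
      bound = MaxWeight≤-resp-↭ G (map⁺ proj₁ (↭-sym t↭s')) (Terminal⇒MaxWeight≤ G 0≤b terminal)
    insert seq@(step {X = A} {MA} {B} {MB} t↭AB bound rest) terminal t↭ wf bounded
      with level (A , MA) (B , MB) ≤? M₀
    ... | yes ≤M₀ = [] , _ , refl , insert-first (MaxWeight≤-mono G (onePlus*-mono-≤ ≤M₀) bound) t↭ bounded seq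
    ... | no ≰M₀
      with Q , T↭ , R↭ ← ↭-∷-avoiding (↭-trans (↭-sym t↭) t↭AB)
                           (XY≢ˡ {A , MA} {B , MB} ≰M₀) (XY≢ʳ {A , MA} {B , MB} ≰M₀)
      with pre , post , σ≡ , seq' ← insert rest terminal (↭-trans (prep _ R↭) (swap _ _ ↭-refl))
             (WellFormed-regroup wf (map⁺ proj₁ T↭)) (Bounded-regroup wf (map⁺ proj₁ T↭) bounded) =
      (A , B) ∷ pre , post , cong ((A , B) ∷_) σ≡ ,
      step (↭-trans (prep _ (prep _ T↭)) (shifts ((X , MX) ∷ (Y , MY) ∷ []) ((A , MA) ∷ (B , MB) ∷ [])))
           (extend (onePlus*-mono-≤ (<⇒≤ (≰⇒> ≰M₀))) t↭ bound bounded)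
           (LeveledSeq-resp-↭ (shift _ ((X , MX) ∷ (Y , MY) ∷ []) Q) seq')

  good⇒bounds : ∀ {X MX Y MY R} → GoodMerge G ε (X , MX) (Y , MY) R →
    let b = onePlus ε * level (X , MX) (Y , MY) in
    wC G X Y ≤ b × 0ℚ ≤ b × All (λ C → wC G X C ≤ b × wC G Y C ≤ b) (clusters R)
  good⇒bounds {X} {MX} {Y} {MY} {R} good =
    ≤-trans (wmax-upper G X {L = Y ∷ clusters R} (here refl)) wmaxX≤b ,
    ≤-trans (wmax-nonNeg G X (Y ∷ clusters R)) wmaxX≤b ,
    All.tabulate λ C∈R → ≤-trans (wmax-upper G X {L = Y ∷ clusters R} (there C∈R)) wmaxX≤b ,
                         ≤-trans (wmax-upper G Y {L = X ∷ clusters R} (there C∈R)) wmaxY≤b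
    where
    wmaxX≤b : wmax G X (Y ∷ clusters R) ≤ onePlus ε * level (X , MX) (Y , MY)
    wmaxX≤b = ≤-trans (p≤p⊔q (wmax G X (Y ∷ clusters R)) (wmax G Y (X ∷ clusters R))) good
    wmaxY≤b : wmax G Y (X ∷ clusters R) ≤ onePlus ε * level (X , MX) (Y , MY)
    wmaxY≤b = ≤-trans (p≤q⊔p (wmax G X (Y ∷ clusters R)) (wmax G Y (X ∷ clusters R))) good

  reorder : ∀ {s ms s'} → GoodRun G ε s ms s' → Terminal G (clusters s') → WellFormed (clusters s) →
    ∃ λ σ → ms ↭ σ × LeveledSeq s σ s'
  reorder done _ _ = [] , ↭-refl , done ↭-refl
  reorder (step {X = X} {MX} {Y} {MY} {R} {ms} s↭ _ good rest) terminal wf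
    with wf' ← WellFormed-resp-↭ (map⁺ proj₁ s↭) wf
    with XY≤b , 0≤b , bounded ← good⇒bounds {X} {MX} {Y} {MY} {R} good
    with σ , ms↭σ , seq ← reorder rest terminal (WellFormed-merge wf')
    with pre , post , σ≡ , seq' ← Insertion.insert X Y MX MY XY≤b 0≤b seq terminal ↭-refl wf' bounded =
    pre ++ (X , Y) ∷ post ,
    ↭-trans (prep (X , Y) (subst (ms ↭_) σ≡ ms↭σ)) (↭-sym (shift (X , Y) pre post)) ,
    LeveledSeq-resp-↭ (↭-sym s↭) seq'

  reorder-approx : ∀ {s ms s'} → GoodRun G ε s ms s' → Terminal G (clusters s') → WellFormed (clusters s) →
    ∃ λ σ → ms ↭ σ × ∃ λ P → ApproxSeq G ε (clusters s) σ P × P ↭ clusters s'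
  reorder-approx run terminal wf with σ , ms↭σ , leveled ← reorder run terminal wf =
    σ , ms↭σ , LeveledSeq⇒ApproxSeq leveled

clusters-initState : ∀ n → clusters (initState n) ≡ singletons n
clusters-initState n = sym (map-∘ (allFin n))

WellFormed-initState : ∀ n → WellFormed (clusters (initState n))
WellFormed-initState n = subst WellFormed (sym (clusters-initState n)) (WellFormed-singletons n)

onePlus-nonNeg : ∀ {ε} → 0ℚ < ε → NonNegative (onePlus ε)
onePlus-nonNeg 0<ε = nonNegative (+-mono-≤ (nonNegative⁻¹ 1ℚ) (<⇒≤ 0<ε))

lemma3p7 : ∀ {n} (G : WGraph n) (ε : ℚ) → 0ℚ < ε →
    (D : List (Merge n)) → GoodHACDendrogram G ε D → IsApproxDendrogram G ε D
lemma3p7 {n} G ε 0<ε D (s , run , terminal)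
  with σ , D↭σ , P , approx , P↭s
         ← Reordering.reorder-approx G ε {{onePlus-nonNeg 0<ε}} run terminal (WellFormed-initState n) =
  σ , ↭⇒Permutation (λ { refl → inj₁ (refl , refl) }) D↭σ ,
  ApproxSeq⇒ConsistentWithTree approx (WellFormed-initState n) ,
  P , subst (λ P₀ → ApproxSeq G ε P₀ σ P) (clusters-initState n) approx ,
  Terminal-resp-↭ G (↭-sym P↭s) terminal
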